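{- Let $p$ be an odd prime, $n\ge 2$ an integer, and $A$ an integer with $|A|<p/2$ and $p\nmid A$. Let $f(x)=Ax\bmod p$ (least positive residue) on $I=\{1,\dots,p-1\}$, and for $0\le j\le n-1$ let $I_j=\{x:1\le x\le p-1,\ x\equiv j\pmod n\}$. Call $f$ a Type (iv) map if there exist $i,j\in\{0,\dots,n-1\}$ with $f(I_i)\cap I_j=\emptyset$. If $p>n^3(n+3)$, then $f$ is a Type (iv) map if and only if $A$ can be written as $$A=\frac{tp-r}{s}\quad\text{with integers } t,r,s,\ \gcd(r,s)=1,\ s>0,\ 1\le |r|+s\le n.$$ -}

module Defs where

open import Data.Nat as ℕ using (ℕ; suc; _≤_; _<_; NonZero)
open import Data.Nat.DivMod using (_%_)
open import Data.Integer as ℤ using (ℤ; +_; ∣_∣)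
open import Data.Integer.DivMod using (_%ℕ_)
open import Data.Integer.GCD using (gcd)
open import Data.Product using (∃; Σ; _×_; _,_)
open import Relation.Binary.PropositionalEquality using (_≡_)
open import Relation.Nullary using (¬_)

-- f(x) = A x mod p, the least non-negative residue (for x ∈ I and p ∤ A this
-- is the least positive residue, lying in {1,…,p-1}).
f : (p : ℕ) .{{_ : NonZero p}} → ℤ → ℕ → ℕ
f p A x = (A ℤ.* (+ x)) %ℕ p

InI : ℕ → ℕ → Set
InI p x = 1 ≤ x × x < p

InIj : (p n : ℕ) .{{_ : NonZero n}} → ℕ → ℕ → Set
InIj p n j x = InI p x × x % n ≡ j

TypeIV : (p n : ℕ) .{{_ : NonZero p}} .{{_ : NonZero n}} → ℤ → Set
TypeIV p n A =
  ∃ λ i → ∃ λ j → i < n × j < n ×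
    (∀ x → InIj p n i x → ¬ InIj p n j (f p A x))

-- A = (t p - r)/s with integers t, r, s, gcd(r,s)=1, s>0, 1 ≤ |r|+s ≤ n.
-- The division is exact: s · A = t p - r.
Representable : (p n : ℕ) → ℤ → Set
Representable p n A =
  ∃ λ (t : ℤ) → ∃ λ (r : ℤ) → ∃ λ (s : ℤ) →
    ℤ.0ℤ ℤ.< s × gcd r s ≡ ℤ.1ℤ ×
    1 ≤ ∣ r ∣ ℕ.+ ∣ s ∣ × ∣ r ∣ ℕ.+ ∣ s ∣ ≤ n ×
    s ℤ.* A ≡ t ℤ.* (+ p) ℤ.- r

-- (⇐) From s·A ≡ -r (mod p): for x in I₀ (r ≥ 0) or in I_{p mod n} (r < 0), with w = x
-- resp. p - x, the number s·f(x) + |r|·w is a multiple of p in (0, n·p); if f(x) ∈ I₀ it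
-- would also be a multiple of n, impossible as gcd(n, p) = 1.
-- (⇒) Dirichlet's pigeonhole argument gives q·A ≡ e (mod p) with 1 ≤ q ≤ n, n·|e| < p,
-- and dividing by gcd(q, |e|) makes q and e coprime. If q + |e| ≤ n this is the required
-- representation. Otherwise, for every pair (i, j), the line |e|·x ≡ q·y (mod p) has a point
-- in I_i × I_j (resp. I_i × I_{p-j} if e < 0): a Bézout lift with a well-chosen offset,
-- slid into [1, p)² by the window lemma, which only needs n³ < p. Such a point has
-- f(x) = y (resp. p - y), so every pair of classes is hit and f is not of Type (iv).
-- The file develops, in order: integer congruences and residues, the direction (⇐),
-- Dirichlet approximation, the window lemma and line points in prescribed classes,
-- the inequalities for admissible offsets, the direction (⇒), and the theorem.

module Submission where

open import Defs
open import Data.Nat as ℕ using (ℕ; zero; suc; z≤n; s≤s; _≤_; _<_; _^_; NonZero)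
import Data.Nat.Properties as ℕₚ
open import Data.Nat.DivMod using (_%_; _/_; m%n<n; m≡m%n+[m/n]*n; m/n*n≡m; m/n≤m; m<n*o⇒m/o<n)
open import Data.Nat.GCD using (module Bézout; gcd; gcd[m,n]∣m; gcd[m,n]∣n; gcd[m,n]≢0)
open import Data.Fin as Fin using (Fin; toℕ; fromℕ<)
import Data.Fin.Properties as Finₚ
import Data.Nat.Divisibility as ℕ∣
open import Data.Nat.Primality using (Prime; euclidsLemma)
open import Data.Nat.Coprimality as Coprimality using (Coprime)
open import Data.Integer as ℤ using (ℤ; +_; -[1+_]; ∣_∣; _+_; _-_; _*_; -_; 0ℤ; 1ℤ)
import Data.Integer.Properties as ℤₚ
open import Data.Integer.DivMod using (_%ℕ_; _/ℕ_; n%ℕd<d; a≡a%ℕn+[a/ℕn]*n)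
open import Data.Integer.Divisibility using (_∣_)
open import Data.Integer.Divisibility.Signed using (divides; ∣⇒∣ᵤ; ∣ᵤ⇒∣)
  renaming (_∣_ to _∣ₛ_)
open import Data.Integer.Tactic.RingSolver using (solve)
open import Data.List using (_∷_; [])
open import Data.Product using (∃₂; Σ; _×_; _,_; proj₁; proj₂)
open import Data.Sum using (_⊎_; inj₁; inj₂)
open import Function.Bundles using (_⇔_; mk⇔)
open import Relation.Nullary using (¬_; Dec; yes; no; contradiction)
open import Relation.Binary.Bundles using (Setoid)
open import Relation.Binary.Structures using (IsEquivalence)
open import Relation.Binary.PropositionalEquality
  using (_≡_; _≢_; refl; sym; trans; cong; cong₂; subst; subst₂; module ≡-Reasoning)
import Relation.Binary.Reasoning.Setoid as SetoidReasoning

infix 4 _≡_mod_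

record _≡_mod_ (a b : ℤ) (m : ℕ) : Set where
  constructor by-divisibility
  field divides-difference : + m ∣ₛ a - b
open _≡_mod_ public

module _ {m : ℕ} where
  open ≡-Reasoning

  mod-intro : ∀ {a b} k → a ≡ b + k * + m → a ≡ b mod m
  mod-intro {a} {b} k eq = by-divisibility (divides k (begin
    a - b             ≡⟨ cong (_- b) eq ⟩
    b + k * + m - b   ≡⟨ cancel b (k * + m) ⟩
    k * + m           ∎))
    where
    cancel : ∀ b u → b + u - b ≡ u
    cancel b u = solve (b ∷ u ∷ [])

  mod-refl : ∀ {a} → a ≡ a mod m
  mod-refl {a} = by-divisibility (divides 0ℤ (ℤₚ.+-inverseʳ a))

  mod-sym : ∀ {a b} → a ≡ b mod m → b ≡ a mod m
  mod-sym {a} {b} (by-divisibility (divides k eq)) = by-divisibility (divides (- k) (begin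
    b - a         ≡⟨ solve (a ∷ b ∷ []) ⟩
    - (a - b)     ≡⟨ cong -_ eq ⟩
    - (k * + m)   ≡⟨ ℤₚ.neg-distribˡ-* k (+ m) ⟩
    - k * + m     ∎))

  mod-trans : ∀ {a b c} → a ≡ b mod m → b ≡ c mod m → a ≡ c mod m
  mod-trans {a} {b} {c} (by-divisibility (divides k eq)) (by-divisibility (divides l eq′)) =
    by-divisibility (divides (k + l) (begin
      a - c               ≡⟨ solve (a ∷ b ∷ c ∷ []) ⟩
      (a - b) + (b - c)   ≡⟨ cong₂ _+_ eq eq′ ⟩
      k * + m + l * + m   ≡⟨ ℤₚ.*-distribʳ-+ (+ m) k l ⟨
      (k + l) * + m       ∎))

  mod-+ : ∀ {a b c d} → a ≡ b mod m → c ≡ d mod m → a + c ≡ b + d mod m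
  mod-+ {a} {b} {c} {d} (by-divisibility (divides k eq)) (by-divisibility (divides l eq′)) =
    by-divisibility (divides (k + l) (begin
      (a + c) - (b + d)   ≡⟨ solve (a ∷ b ∷ c ∷ d ∷ []) ⟩
      (a - b) + (c - d)   ≡⟨ cong₂ _+_ eq eq′ ⟩
      k * + m + l * + m   ≡⟨ ℤₚ.*-distribʳ-+ (+ m) k l ⟨
      (k + l) * + m       ∎))

  mod-*ˡ : ∀ c {a b} → a ≡ b mod m → c * a ≡ c * b mod m
  mod-*ˡ c {a} {b} (by-divisibility (divides k eq)) = by-divisibility (divides (c * k) (begin
    c * a - c * b   ≡⟨ solve (a ∷ b ∷ c ∷ []) ⟩
    c * (a - b)     ≡⟨ cong (c *_) eq ⟩
    c * (k * + m)   ≡⟨ ℤₚ.*-assoc c k (+ m) ⟨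
    c * k * + m     ∎))

  mod-*ʳ : ∀ c {a b} → a ≡ b mod m → a * c ≡ b * c mod m
  mod-*ʳ c {a} {b} a≡b = subst₂ (λ x y → x ≡ y mod m) (ℤₚ.*-comm c a) (ℤₚ.*-comm c b) (mod-*ˡ c a≡b)

  mod-neg : ∀ {a b} → a ≡ b mod m → - a ≡ - b mod m
  mod-neg {a} {b} (by-divisibility (divides k eq)) = by-divisibility (divides (- k) (begin
    - a - - b     ≡⟨ solve (a ∷ b ∷ []) ⟩
    - (a - b)     ≡⟨ cong -_ eq ⟩
    - (k * + m)   ≡⟨ ℤₚ.neg-distribˡ-* k (+ m) ⟩
    - k * + m     ∎))

  mod-isEquivalence : IsEquivalence (λ a b → a ≡ b mod m)
  mod-isEquivalence = record { refl = mod-refl ; sym = mod-sym ; trans = mod-trans }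

mod-setoid : ℕ → Setoid _ _
mod-setoid m = record { isEquivalence = mod-isEquivalence {m} }

module ModReasoning (m : ℕ) = SetoidReasoning (mod-setoid m)

-- An equation x = y follows once x - y is written as a combination of the
-- differences a - a′ (and b - b′) of known equations a = a′ (and b = b′).
combine₁ : ∀ {x y a a′} k → a ≡ a′ → x - y ≡ k * (a - a′) → x ≡ y
combine₁ {x} {y} {a} k refl eq = ℤₚ.i-j≡0⇒i≡j x y (trans eq (vanish k a))
  where
  vanish : ∀ k a → k * (a - a) ≡ 0ℤ
  vanish k a = solve (k ∷ a ∷ [])

combine₂ : ∀ {x y a a′ b b′} k l → a ≡ a′ → b ≡ b′ →
  x - y ≡ k * (a - a′) + l * (b - b′) → x ≡ y
combine₂ {x} {y} {a} {_} {b} k l refl refl eq = ℤₚ.i-j≡0⇒i≡j x y (trans eq (vanish k l a b))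
  where
  vanish : ∀ k l a b → k * (a - a) + l * (b - b) ≡ 0ℤ
  vanish k l a b = solve (k ∷ l ∷ a ∷ b ∷ [])

∣-below⇒≡0 : ∀ {m k} → m ℕ∣.∣ k → k < m → k ≡ 0
∣-below⇒≡0 {k = zero}  _   _   = refl
∣-below⇒≡0 {k = suc _} m∣k k<m = contradiction m∣k (ℕ∣.>⇒∤ k<m)

ordered-residue-unique : ∀ {m r j} → j ≤ r → r < m → + r ≡ + j mod m → r ≡ j
ordered-residue-unique {m} {r} {j} j≤r r<m (by-divisibility m∣r-j) =
  ℕₚ.≤-antisym (ℕₚ.m∸n≡0⇒m≤n r∸j≡0) j≤r
  where
  m∣r∸j : m ℕ∣.∣ r ℕ.∸ j
  m∣r∸j = subst (m ℕ∣.∣_) (cong ∣_∣ (trans (ℤₚ.m-n≡m⊖n r j) (ℤₚ.⊖-≥ j≤r))) (∣⇒∣ᵤ m∣r-j)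
  r∸j≡0 : r ℕ.∸ j ≡ 0
  r∸j≡0 = ∣-below⇒≡0 m∣r∸j (ℕₚ.≤-<-trans (ℕₚ.m∸n≤m r j) r<m)

residue-unique : ∀ {m r j} → r < m → j < m → + r ≡ + j mod m → r ≡ j
residue-unique {r = r} {j} r<m j<m r≡j with ℕₚ.≤-total j r
... | inj₁ j≤r = ordered-residue-unique j≤r r<m r≡j
... | inj₂ r≤j = sym (ordered-residue-unique r≤j j<m (mod-sym r≡j))

%ℕ-congruent : ∀ a m .{{_ : NonZero m}} → + (a %ℕ m) ≡ a mod m
%ℕ-congruent a m = mod-sym (mod-intro (a /ℕ m) (a≡a%ℕn+[a/ℕn]*n a m))

%ℕ-unique : ∀ a {m} .{{_ : NonZero m}} {j} → j < m → a ≡ + j mod m → a %ℕ m ≡ j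
%ℕ-unique a {m} j<m a≡j = residue-unique (n%ℕd<d a m) j<m (mod-trans (%ℕ-congruent a m) a≡j)

prime-cancel : ∀ {p g a b} → Prime p → 1 ≤ g → g < p → + g * a ≡ + g * b mod p → a ≡ b mod p
prime-cancel {p} {g} {a} {b} p-prime 1≤g g<p (by-divisibility p∣ga-gb)
  with euclidsLemma g ∣ a - b ∣ p-prime p∣g∣a-b∣
  where
  p∣g∣a-b∣ : p ℕ∣.∣ g ℕ.* ∣ a - b ∣
  p∣g∣a-b∣ = subst (p ℕ∣.∣_)
    (trans (cong ∣_∣ (factor (+ g) a b)) (ℤₚ.abs-* (+ g) (a - b)))
    (∣⇒∣ᵤ p∣ga-gb)
    where
    factor : ∀ g a b → g * a - g * b ≡ g * (a - b)
    factor g a b = solve (g ∷ a ∷ b ∷ [])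
... | inj₁ p∣g = contradiction p∣g (ℕ∣.>⇒∤ {{ℕ.>-nonZero 1≤g}} g<p)
... | inj₂ p∣a-b = by-divisibility (∣ᵤ⇒∣ p∣a-b)

f-congruent : ∀ p .{{_ : NonZero p}} A x → + f p A x ≡ A * + x mod p
f-congruent p A x = %ℕ-congruent (A * + x) p

f-unique : ∀ {p} .{{_ : NonZero p}} A x {y} → y < p → + y ≡ A * + x mod p → f p A x ≡ y
f-unique A x y<p y≡Ax = %ℕ-unique (A * + x) y<p (mod-sym y≡Ax)

%-congruent : ∀ x n .{{_ : NonZero n}} → + (x % n) ≡ + x mod n
%-congruent x n = %ℕ-congruent (+ x) n

%-unique : ∀ {x n} .{{_ : NonZero n}} {j} → j < n → + x ≡ + j mod n → x % n ≡ j
%-unique {x} j<n = %ℕ-unique (+ x) j<n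

≡0⇒∣ : ∀ {n k} → + k ≡ 0ℤ mod n → n ℕ∣.∣ k
≡0⇒∣ {n} {k} (by-divisibility n∣k-0) =
  subst (n ℕ∣.∣_) (cong ∣_∣ (ℤₚ.+-identityʳ (+ k))) (∣⇒∣ᵤ n∣k-0)

pos-∸ : ∀ {p x} → x ≤ p → + (p ℕ.∸ x) ≡ + p - + x
pos-∸ {p} {x} x≤p = sym (trans (ℤₚ.m-n≡m⊖n p x) (ℤₚ.⊖-≥ x≤p))

same-class⇒∣∸ : ∀ {x p n} .{{_ : NonZero n}} → x ≤ p → x % n ≡ p % n → n ℕ∣.∣ p ℕ.∸ x
same-class⇒∣∸ {x} {p} {n} x≤p same = ≡0⇒∣ (begin
  + (p ℕ.∸ x)   ≡⟨ pos-∸ x≤p ⟩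
  + p - + x     ≈⟨ mod-+ p≡x (mod-refl {a = - + x}) ⟨
  + x - + x     ≡⟨ ℤₚ.+-inverseʳ (+ x) ⟩
  0ℤ            ∎)
  where
  open ModReasoning n
  p≡x : + x ≡ + p mod n
  p≡x = begin
    + x           ≈⟨ %-congruent x n ⟨
    + (x % n)     ≡⟨ cong +_ same ⟩
    + (p % n)     ≈⟨ %-congruent p n ⟩
    + p           ∎

-- A positive multiple of the prime p below n·p is not divisible by n < p:
-- it is p·z with 0 < z < n, and n ∣ p·z forces n ∣ z since gcd(n, p) = 1.
no-small-common-multiple : ∀ {p n N} .{{_ : NonZero n}} → Prime p → n < p →
  1 ≤ N → N < n ℕ.* p → p ℕ∣.∣ N → ¬ (n ℕ∣.∣ N)
no-small-common-multiple {p} {n} p-prime n<p 1≤N N<np (ℕ∣.divides z refl) n∣zp =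
  contradiction n∣z (ℕ∣.>⇒∤ {{z≢0}} z<n)
  where
  n∣z : n ℕ∣.∣ z
  n∣z = Coprimality.coprime-divisor (Coprimality.sym (Coprimality.prime⇒coprime p-prime n<p))
          (subst (n ℕ∣.∣_) (ℕₚ.*-comm z p) n∣zp)
  z<n : z < n
  z<n = ℕₚ.*-cancelʳ-< p z n N<np
  z≢0 : NonZero z
  z≢0 = ℕ.≢-nonZero λ { refl → contradiction 1≤N λ () }

combination-bounds : ∀ {p n s R y w} → 1 ≤ s → 1 ≤ y → y < p → w ≤ p → R ℕ.+ s ≤ n →
  1 ≤ s ℕ.* y ℕ.+ R ℕ.* w × s ℕ.* y ℕ.+ R ℕ.* w < n ℕ.* p
combination-bounds {p} {n} {s} {R} {y} {w} 1≤s 1≤y y<p w≤p R+s≤n =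
  ℕₚ.≤-trans (ℕₚ.*-mono-≤ 1≤s 1≤y) (ℕₚ.m≤m+n (s ℕ.* y) (R ℕ.* w)) ,
  (begin-strict
    s ℕ.* y ℕ.+ R ℕ.* w   <⟨ ℕₚ.+-mono-<-≤ (ℕₚ.*-monoʳ-< s {{ℕ.>-nonZero 1≤s}} y<p) (ℕₚ.*-monoʳ-≤ R w≤p) ⟩
    s ℕ.* p ℕ.+ R ℕ.* p   ≡⟨ ℕₚ.*-distribʳ-+ p s R ⟨
    (s ℕ.+ R) ℕ.* p       ≡⟨ cong (ℕ._* p) (ℕₚ.+-comm s R) ⟩
    (R ℕ.+ s) ℕ.* p       ≤⟨ ℕₚ.*-monoˡ-≤ p R+s≤n ⟩
    n ℕ.* p               ∎)
  where open ℕₚ.≤-Reasoning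

pos-combination : ∀ s y R w → + (s ℕ.* y ℕ.+ R ℕ.* w) ≡ + s * + y + + R * + w
pos-combination s y R w = trans (ℤₚ.pos-+ (s ℕ.* y) (R ℕ.* w)) (cong₂ _+_ (ℤₚ.pos-* s y) (ℤₚ.pos-* R w))

-- Let s·A ≡ -r (mod p) with 1 ≤ s and |r| + s ≤ n, and let w ≤ p with n ∣ w and
-- |r|·w ≡ r·x (mod p). Then f(x) ∉ I₀: otherwise N = s·f(x) + |r|·w ≡ (s·A + r)·x ≡ 0
-- (mod p) would be a common multiple of n and p strictly between 0 and n·p.
image-avoids-I₀ : ∀ {p n s r A} .{{_ : NonZero p}} .{{_ : NonZero n}} → Prime p → n < p →
  1 ≤ s → ∣ r ∣ ℕ.+ s ≤ n → + s * A ≡ - r mod p →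
  ∀ x w → w ≤ p → n ℕ∣.∣ w → + ∣ r ∣ * + w ≡ r * + x mod p → ¬ InIj p n 0 (f p A x)
image-avoids-I₀ {p} {n} {s} {r} {A} p-prime n<p 1≤s bound sA≡-r x w w≤p n∣w Rw≡rx
  ((1≤y , y<p) , y%n≡0) = no-small-common-multiple p-prime n<p
    (proj₁ bounds) (proj₂ bounds) (≡0⇒∣ N≡0) (ℕ∣.∣m∣n⇒∣m+n (ℕ∣.∣n⇒∣m*n s n∣y) (ℕ∣.∣n⇒∣m*n ∣ r ∣ n∣w))
  where
  y : ℕ
  y = f p A x
  bounds : 1 ≤ s ℕ.* y ℕ.+ ∣ r ∣ ℕ.* w × s ℕ.* y ℕ.+ ∣ r ∣ ℕ.* w < n ℕ.* p
  bounds = combination-bounds {R = ∣ r ∣} 1≤s 1≤y y<p w≤p bound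
  n∣y : n ℕ∣.∣ y
  n∣y = ℕ∣.m%n≡0⇒n∣m y n y%n≡0
  regroup : ∀ s A r x → s * (A * x) + r * x ≡ (s * A + r) * x
  regroup s A r x = solve (s ∷ A ∷ r ∷ x ∷ [])
  cancel : ∀ r x → (- r + r) * x ≡ 0ℤ
  cancel r x = solve (r ∷ x ∷ [])
  open ModReasoning p
  N≡0 : + (s ℕ.* y ℕ.+ ∣ r ∣ ℕ.* w) ≡ 0ℤ mod p
  N≡0 = begin
    + (s ℕ.* y ℕ.+ ∣ r ∣ ℕ.* w)   ≡⟨ pos-combination s y ∣ r ∣ w ⟩
    + s * + y + + ∣ r ∣ * + w     ≈⟨ mod-+ (mod-*ˡ (+ s) (f-congruent p A x)) Rw≡rx ⟩
    + s * (A * + x) + r * + x     ≡⟨ regroup (+ s) A r (+ x) ⟩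
    (+ s * A + r) * + x           ≈⟨ mod-*ʳ (+ x) (mod-+ sA≡-r (mod-refl {a = r})) ⟩
    (- r + r) * + x               ≡⟨ cancel r (+ x) ⟩
    0ℤ                            ∎

-- The class I_i playing the role of x in image-avoids-I₀: for r ≥ 0 take i = 0 and
-- w = x; for r < 0 take i = p mod n and w = p - x, so that |r|·w ≡ r·x (mod p).
partner-class : ∀ {p n} .{{_ : NonZero n}} (r : ℤ) → Σ ℕ λ i → i < n ×
  (∀ x → InIj p n i x → Σ ℕ λ w → w ≤ p × n ℕ∣.∣ w × + ∣ r ∣ * + w ≡ r * + x mod p)
partner-class {p} {n} (+ R) = 0 , ℕ.>-nonZero⁻¹ n , λ x ((_ , x<p) , x%n≡0) →
  x , ℕₚ.<⇒≤ x<p , ℕ∣.m%n≡0⇒n∣m x n x%n≡0 , mod-refl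
partner-class {p} {n} r@(-[1+ R′ ]) = p % n , m%n<n p n , λ x ((_ , x<p) , x%n≡p%n) →
  p ℕ.∸ x , ℕₚ.m∸n≤m p x , same-class⇒∣∸ (ℕₚ.<⇒≤ x<p) x%n≡p%n ,
  mod-intro (+ suc R′) (trans (cong (+ suc R′ *_) (pos-∸ (ℕₚ.<⇒≤ x<p))) (reflect (+ suc R′) (+ p) (+ x)))
  where
  reflect : ∀ R P X → R * (P - X) ≡ - R * X + R * P
  reflect R P X = solve (R ∷ P ∷ X ∷ [])

representable⇒typeIV : ∀ {p n A} .{{_ : NonZero p}} .{{_ : NonZero n}} → Prime p → n < p →
  Representable p n A → TypeIV p n A
representable⇒typeIV {p} {n} {A} p-prime n<p (t , r , + s , ℤ.+<+ 1≤s , _ , _ , bound , sA≡tp-r)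
  with partner-class {p} {n} r
... | i , i<n , partner = i , 0 , i<n , ℕ.>-nonZero⁻¹ n , λ x x∈Iᵢ →
  let w , w≤p , n∣w , Rw≡rx = partner x x∈Iᵢ in avoids x w w≤p n∣w Rw≡rx
  where
  avoids : ∀ x w → w ≤ p → n ℕ∣.∣ w → + ∣ r ∣ * + w ≡ r * + x mod p → ¬ InIj p n 0 (f p A x)
  avoids = image-avoids-I₀ {r = r} p-prime n<p 1≤s bound
             (mod-intro t (trans sA≡tp-r (ℤₚ.+-comm (t * + p) (- r))))

record Approximation (p n : ℕ) (A : ℤ) : Set where
  field
    q       : ℕ
    e       : ℤ
    1≤q     : 1 ≤ q
    q≤n     : q ≤ n
    n∣e∣<p  : n ℕ.* ∣ e ∣ < p
    qA≡e    : + q * A ≡ e mod p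

∣pos-pos∣ : ∀ a b → ∣ + a - + b ∣ ≡ ℕ.∣ a - b ∣
∣pos-pos∣ a b with ℕₚ.≤-total b a
... | inj₁ b≤a = trans (cong ∣_∣ (trans (ℤₚ.m-n≡m⊖n a b) (ℤₚ.⊖-≥ b≤a)))
                       (sym (ℕₚ.m≤n⇒∣n-m∣≡n∸m b≤a))
... | inj₂ a≤b = trans (cong ∣_∣ (ℤₚ.m-n≡m⊖n a b))
                       (trans (ℤₚ.∣⊖∣-≤ a≤b) (sym (ℕₚ.m≤n⇒∣m-n∣≡n∸m a≤b)))

same-box⇒close : ∀ n p .{{_ : NonZero p}} {v₁ v₂} → v₁ < p → v₂ < p →
  (v₁ ℕ.* n) / p ≡ (v₂ ℕ.* n) / p → n ℕ.* ∣ + v₂ - + v₁ ∣ < p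
same-box⇒close n p {v₁} {v₂} v₁<p v₂<p same-box = begin-strict
  n ℕ.* ∣ + v₂ - + v₁ ∣              ≡⟨ cong (n ℕ.*_) (∣pos-pos∣ v₂ v₁) ⟩
  n ℕ.* ℕ.∣ v₂ - v₁ ∣                 ≡⟨ ℕₚ.*-distribˡ-∣-∣ n v₂ v₁ ⟩
  ℕ.∣ n ℕ.* v₂ - n ℕ.* v₁ ∣           ≡⟨ cong₂ ℕ.∣_-_∣ (split v₂ refl) (split v₁ same-box) ⟩
  ℕ.∣ B ℕ.* p ℕ.+ ρ v₂ - B ℕ.* p ℕ.+ ρ v₁ ∣ ≡⟨ ℕₚ.∣m+n-m+o∣≡∣n-o∣ (B ℕ.* p) (ρ v₂) (ρ v₁) ⟩
  ℕ.∣ ρ v₂ - ρ v₁ ∣                   ≤⟨ ℕₚ.∣m-n∣≤m⊔n (ρ v₂) (ρ v₁) ⟩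
  ρ v₂ ℕ.⊔ ρ v₁                       <⟨ ℕₚ.⊔-lub (m%n<n (v₂ ℕ.* n) p) (m%n<n (v₁ ℕ.* n) p) ⟩
  p                                   ∎
  where
  open ℕₚ.≤-Reasoning
  ρ : ℕ → ℕ
  ρ v = (v ℕ.* n) % p
  B : ℕ
  B = (v₂ ℕ.* n) / p
  split : ∀ v → (v ℕ.* n) / p ≡ B → n ℕ.* v ≡ B ℕ.* p ℕ.+ ρ v
  split v quotient≡B = begin-equality
    n ℕ.* v                            ≡⟨ ℕₚ.*-comm n v ⟩
    v ℕ.* n                            ≡⟨ m≡m%n+[m/n]*n (v ℕ.* n) p ⟩
    ρ v ℕ.+ (v ℕ.* n) / p ℕ.* p        ≡⟨ cong (λ b → ρ v ℕ.+ b ℕ.* p) quotient≡B ⟩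
    ρ v ℕ.+ B ℕ.* p                    ≡⟨ ℕₚ.+-comm (ρ v) (B ℕ.* p) ⟩
    B ℕ.* p ℕ.+ ρ v                    ∎

-- Dirichlet's principle: of the n + 1 values f(0), …, f(n), two (at k₁ < k₂) lie in the same
-- of the n intervals [B·p/n, (B+1)·p/n); then q = k₂ - k₁ and e = f(k₂) - f(k₁) approximate.
dirichlet : ∀ p n A .{{_ : NonZero p}} .{{_ : NonZero n}} → Approximation p n A
dirichlet p n A = from-collision (Finₚ.pigeonhole (ℕₚ.n<1+n n) box)
  where
  v : Fin (suc n) → ℕ
  v k = f p A (toℕ k)
  box-bound : ∀ k → (v k ℕ.* n) / p < n
  box-bound k = m<n*o⇒m/o<n (subst (v k ℕ.* n <_) (ℕₚ.*-comm p n)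
                  (ℕₚ.*-monoˡ-< n (n%ℕd<d (A * + toℕ k) p)))
  box : Fin (suc n) → Fin n
  box k = fromℕ< (box-bound k)
  expand : ∀ K₂ K₁ A → (K₂ - K₁) * A ≡ A * K₂ - A * K₁
  expand K₂ K₁ A = solve (K₂ ∷ K₁ ∷ A ∷ [])
  open ModReasoning p
  from-collision : ∃₂ (λ k₁ k₂ → k₁ Fin.< k₂ × box k₁ ≡ box k₂) → Approximation p n A
  from-collision (k₁ , k₂ , k₁<k₂ , same-box) = record
    { q      = toℕ k₂ ℕ.∸ toℕ k₁
    ; e      = + v k₂ - + v k₁
    ; 1≤q    = ℕₚ.m<n⇒0<n∸m k₁<k₂
    ; q≤n    = ℕₚ.≤-trans (ℕₚ.m∸n≤m (toℕ k₂) (toℕ k₁)) (ℕₚ.≤-pred (Finₚ.toℕ<n k₂))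
    ; n∣e∣<p = same-box⇒close n p (n%ℕd<d (A * + toℕ k₁) p) (n%ℕd<d (A * + toℕ k₂) p)
                 (trans (sym (Finₚ.toℕ-fromℕ< (box-bound k₁)))
                   (trans (cong toℕ same-box) (Finₚ.toℕ-fromℕ< (box-bound k₂))))
    ; qA≡e   = begin
        + (toℕ k₂ ℕ.∸ toℕ k₁) * A        ≡⟨ cong (_* A) (pos-∸ (ℕₚ.<⇒≤ k₁<k₂)) ⟩
        (+ toℕ k₂ - + toℕ k₁) * A        ≡⟨ expand (+ toℕ k₂) (+ toℕ k₁) A ⟩
        A * + toℕ k₂ - A * + toℕ k₁      ≈⟨ mod-+ (mod-sym (f-congruent p A (toℕ k₂)))
                                                 (mod-neg (mod-sym (f-congruent p A (toℕ k₁)))) ⟩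
        + v k₂ - + v k₁                  ∎
    }

factor-abs : ∀ e k g → ∣ e ∣ ≡ k ℕ.* g → Σ ℤ λ e′ → e ≡ e′ * + g × ∣ e′ ∣ ≡ k
factor-abs (+ _)      k g eq = + k , trans (cong +_ eq) (ℤₚ.pos-* k g) , refl
factor-abs -[1+ _ ]   k g eq = - + k ,
  trans (cong (λ m → - + m) eq) (trans (cong -_ (ℤₚ.pos-* k g)) (ℤₚ.neg-distribˡ-* (+ k) (+ g))) ,
  ℤₚ.∣-i∣≡∣i∣ (+ k)

-- Dividing q and e by g = gcd(q, |e|) keeps an approximation (g·(q′·A) ≡ g·e′ (mod p), and
-- 0 < g ≤ q < p cancels) and makes it coprime.
coprime-approximation : ∀ {p n A} → Prime p → n < p → Approximation p n A →
  Σ (Approximation p n A) λ a → Coprime (Approximation.q a) ∣ Approximation.e a ∣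
coprime-approximation {p} {n} {A} p-prime n<p approx =
  record { q = q′ ; e = e′ ; 1≤q = 1≤q′ ; q≤n = ℕₚ.≤-trans q′≤q q≤n
         ; n∣e∣<p = n∣e′∣<p ; qA≡e = q′A≡e′ } ,
  subst (Coprime q′) (sym ∣e′∣≡E′) (Coprimality.coprime-/gcd q ∣ e ∣)
  where
  open Approximation approx
  g : ℕ
  g = gcd q ∣ e ∣
  instance
    g≢0 : NonZero g
    g≢0 = ℕ.≢-nonZero (gcd[m,n]≢0 q ∣ e ∣ (inj₁ λ { refl → contradiction 1≤q λ () }))
  q′ E′ : ℕ
  q′ = q / g
  E′ = ∣ e ∣ / g
  q′g≡q : q′ ℕ.* g ≡ q
  q′g≡q = m/n*n≡m (gcd[m,n]∣m q ∣ e ∣)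
  factored : Σ ℤ λ e′ → e ≡ e′ * + g × ∣ e′ ∣ ≡ E′
  factored = factor-abs e E′ g (sym (m/n*n≡m (gcd[m,n]∣n q ∣ e ∣)))
  e′ : ℤ
  e′ = proj₁ factored
  e≡e′g : e ≡ e′ * + g
  e≡e′g = proj₁ (proj₂ factored)
  ∣e′∣≡E′ : ∣ e′ ∣ ≡ E′
  ∣e′∣≡E′ = proj₂ (proj₂ factored)
  1≤g : 1 ≤ g
  1≤g = ℕ.>-nonZero⁻¹ g
  g≤q : g ≤ q
  g≤q = ℕ∣.∣⇒≤ {{ℕ.>-nonZero 1≤q}} (gcd[m,n]∣m q ∣ e ∣)
  1≤q′ : 1 ≤ q′
  1≤q′ = ℕ.>-nonZero⁻¹ q′ {{ℕₚ.m*n≢0⇒m≢0 q′ {{ℕ.>-nonZero (subst (1 ≤_) (sym q′g≡q) 1≤q)}}}}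
  q′≤q : q′ ≤ q
  q′≤q = m/n≤m q g
  n∣e′∣<p : n ℕ.* ∣ e′ ∣ < p
  n∣e′∣<p = ℕₚ.≤-<-trans (ℕₚ.*-monoʳ-≤ n (subst (_≤ ∣ e ∣) (sym ∣e′∣≡E′) (m/n≤m ∣ e ∣ g))) n∣e∣<p
  regroup : ∀ g q A → g * (q * A) ≡ q * g * A
  regroup g q A = solve (g ∷ q ∷ A ∷ [])
  open ModReasoning p
  gq′A≡ge′ : + g * (+ q′ * A) ≡ + g * e′ mod p
  gq′A≡ge′ = begin
    + g * (+ q′ * A)   ≡⟨ regroup (+ g) (+ q′) A ⟩
    + q′ * + g * A     ≡⟨ cong (_* A) (trans (sym (ℤₚ.pos-* q′ g)) (cong +_ q′g≡q)) ⟩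
    + q * A            ≈⟨ qA≡e ⟩
    e                  ≡⟨ e≡e′g ⟩
    e′ * + g           ≡⟨ ℤₚ.*-comm e′ (+ g) ⟩
    + g * e′           ∎
  q′A≡e′ : + q′ * A ≡ e′ mod p
  q′A≡e′ = prime-cancel p-prime 1≤g (ℕₚ.≤-<-trans (ℕₚ.≤-trans g≤q q≤n) n<p) gq′A≡ge′

representative : ∀ v₀ N .{{_ : NonZero N}} → Σ ℕ λ r → Σ ℤ λ d → r < N × v₀ ≡ + suc r + d * + N
representative v₀ N = r , d , n%ℕd<d (v₀ - 1ℤ) N ,
  combine₁ 1ℤ (a≡a%ℕn+[a/ℕn]*n (v₀ - 1ℤ) N) (shift v₀ (+ r) (d * + N))
  where
  r : ℕ
  r = (v₀ - 1ℤ) %ℕ N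
  d : ℤ
  d = (v₀ - 1ℤ) /ℕ N
  shift : ∀ v₀ r dN → v₀ - (1ℤ + r + dN) ≡ 1ℤ * (v₀ - 1ℤ - (r + dN))
  shift v₀ r dN = solve (v₀ ∷ r ∷ dN ∷ [])

nonneg-quotient : ∀ {b M} U → 1 ≤ b → + b * U ≡ + M → Σ ℕ λ u → U ≡ + u × b ℕ.* u ≡ M
nonneg-quotient {b} (+ u) _ eq = u , refl , ℤₚ.+-injective (trans (ℤₚ.pos-* b u) eq)
nonneg-quotient {suc b} -[1+ _ ] _ ()

forced-range : ∀ {P n a b K u v} → 1 ≤ a → 1 ≤ v → v ≤ n ℕ.* b → n ℕ.* a ℕ.* b ℕ.+ P ℕ.* K < P ℕ.* b →
  b ℕ.* u ≡ a ℕ.* v ℕ.+ P ℕ.* K → InI P u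
forced-range {P} {n} {a} {b} {K} {u} {v} 1≤a 1≤v v≤nb nab+PK<Pb bu≡av+PK =
  ℕ.>-nonZero⁻¹ u {{ℕₚ.m*n≢0⇒n≢0 b {{ℕ.>-nonZero 1≤bu}}}} ,
  ℕₚ.*-cancelˡ-< b u P (begin-strict
    b ℕ.* u                       ≡⟨ bu≡av+PK ⟩
    a ℕ.* v ℕ.+ P ℕ.* K           ≤⟨ ℕₚ.+-monoˡ-≤ (P ℕ.* K) (ℕₚ.*-monoʳ-≤ a v≤nb) ⟩
    a ℕ.* (n ℕ.* b) ℕ.+ P ℕ.* K   ≡⟨ cong (ℕ._+ P ℕ.* K) (reorder a n b) ⟩
    n ℕ.* a ℕ.* b ℕ.+ P ℕ.* K     <⟨ nab+PK<Pb ⟩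
    P ℕ.* b                       ≡⟨ ℕₚ.*-comm P b ⟩
    b ℕ.* P                       ∎)
  where
  open ℕₚ.≤-Reasoning
  1≤bu : 1 ≤ b ℕ.* u
  1≤bu = subst (1 ≤_) (sym bu≡av+PK)
           (ℕₚ.≤-trans (ℕₚ.*-mono-≤ 1≤a 1≤v) (ℕₚ.m≤m+n (a ℕ.* v) (P ℕ.* K)))
  reorder : ∀ a n b → a ℕ.* (n ℕ.* b) ≡ n ℕ.* a ℕ.* b
  reorder a n b = trans (sym (ℕₚ.*-assoc a n b)) (cong (ℕ._* b) (ℕₚ.*-comm a n))

record LinePoint (P n a b : ℕ) (i j : ℤ) : Set where
  field
    x       : ℕ
    y       : ℕ
    x∈I     : InI P x
    y∈I     : InI P y
    x≡i     : + x ≡ i mod n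
    y≡j     : + y ≡ j mod n
    on-line : + b * + x ≡ + a * + y mod P

-- Side conditions under which the line b·u = a·v + P·K meets [1, P)² in every
-- residue class along its direction (n·a, n·b).
WindowBound : (P n a b K : ℕ) → Set
WindowBound P n a b K = 1 ≤ a × 1 ≤ b × n ℕ.* b < P × n ℕ.* a ℕ.* b ℕ.+ P ℕ.* K < P ℕ.* b

-- Window lemma: sliding an integer point (u₀, v₀) of the line b·u = a·v + P·K along
-- (n·a, n·b) brings it into [1, P)². Take v ∈ [1, n·b] with v ≡ v₀ (mod n·b); then
-- b·u = a·v + P·K lies in [1, P·b), so 1 ≤ u < P.
window : ∀ {P n a b K} .{{_ : NonZero n}} → WindowBound P n a b K → (u₀ v₀ : ℤ) →
  + b * u₀ ≡ + a * v₀ + + P * + K → LinePoint P n a b u₀ v₀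
window {P} {n} {a} {b} {K} (1≤a , 1≤b , nb<P , nab+PK<Pb) u₀ v₀ line
  with representative v₀ (n ℕ.* b) {{ℕ.>-nonZero (ℕₚ.*-mono-≤ (ℕ.>-nonZero⁻¹ n) 1≤b)}}
... | r , d , r<nb , v₀≡v+dnb = record
  { x       = u
  ; y       = v
  ; x∈I     = forced-range {n = n} 1≤a (s≤s z≤n) r<nb nab+PK<Pb bu≡av+PK
  ; y∈I     = s≤s z≤n , ℕₚ.<-≤-trans (s≤s r<nb) nb<P
  ; x≡i     = mod-intro (- d * + a) (trans (sym U≡u) (slide-u u₀ d (+ n) (+ a)))
  ; y≡j     = mod-sym (mod-intro (d * + b) (trans v₀≡v+dnb′ (slide-v (+ v) d (+ n) (+ b))))
  ; on-line = on-line
  }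
  where
  v : ℕ
  v = suc r
  v₀≡v+dnb′ : v₀ ≡ + v + d * (+ n * + b)
  v₀≡v+dnb′ = trans v₀≡v+dnb (cong (λ m → + v + d * m) (ℤₚ.pos-* n b))
  U : ℤ
  U = u₀ - d * (+ n * + a)
  slide-line : ∀ a b u₀ v₀ v d n P K →
    b * (u₀ - d * (n * a)) - (a * v + P * K) ≡ 1ℤ * (b * u₀ - (a * v₀ + P * K)) + a * (v₀ - (v + d * (n * b)))
  slide-line a b u₀ v₀ v d n P K = solve (a ∷ b ∷ u₀ ∷ v₀ ∷ v ∷ d ∷ n ∷ P ∷ K ∷ [])
  slide-u : ∀ u₀ d n a → u₀ - d * (n * a) ≡ u₀ + (- d * a) * n
  slide-u u₀ d n a = solve (u₀ ∷ d ∷ n ∷ a ∷ [])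
  slide-v : ∀ v d n b → v + d * (n * b) ≡ v + d * b * n
  slide-v v d n b = solve (v ∷ d ∷ n ∷ b ∷ [])
  bU≡av+PK : + b * U ≡ + a * + v + + P * + K
  bU≡av+PK = combine₂ 1ℤ (+ a) line v₀≡v+dnb′ (slide-line (+ a) (+ b) u₀ v₀ (+ v) d (+ n) (+ P) (+ K))
  solution : Σ ℕ λ u → U ≡ + u × b ℕ.* u ≡ a ℕ.* v ℕ.+ P ℕ.* K
  solution = nonneg-quotient U 1≤b (trans bU≡av+PK (sym (pos-combination a v P K)))
  u : ℕ
  u = proj₁ solution
  U≡u : U ≡ + u
  U≡u = proj₁ (proj₂ solution)
  bu≡av+PK : b ℕ.* u ≡ a ℕ.* v ℕ.+ P ℕ.* K
  bu≡av+PK = proj₂ (proj₂ solution)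
  on-line : + b * + u ≡ + a * + v mod P
  on-line = mod-intro (+ K) (begin
    + b * + u                ≡⟨ cong (+ b *_) U≡u ⟨
    + b * U                  ≡⟨ bU≡av+PK ⟩
    + a * + v + + P * + K    ≡⟨ cong (λ t → + a * + v + t) (ℤₚ.*-comm (+ P) (+ K)) ⟩
    + a * + v + + K * + P    ∎)
    where open ≡-Reasoning

cast-identity : ∀ x y m n → 1 ℕ.+ y ℕ.* n ≡ x ℕ.* m → + x * + m ≡ 1ℤ + + y * + n
cast-identity x y m n eq = trans (sym (ℤₚ.pos-* x m)) (trans (cong +_ (sym eq))
  (trans (ℤₚ.pos-+ 1 (y ℕ.* n)) (cong (λ t → 1ℤ + t) (ℤₚ.pos-* y n))))

bezout : ∀ {m n} → Coprime m n → Σ ℤ λ u → Σ ℤ λ v → u * + m + v * + n ≡ 1ℤ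
bezout {m} {n} coprime with Coprimality.coprime-Bézout coprime
... | Bézout.+- x y 1+yn≡xm = + x , - + y ,
  combine₁ 1ℤ (cast-identity x y m n 1+yn≡xm) (rearrange (+ x) (+ y) (+ m) (+ n))
  where
  rearrange : ∀ x y m n → x * m + - y * n - 1ℤ ≡ 1ℤ * (x * m - (1ℤ + y * n))
  rearrange x y m n = solve (x ∷ y ∷ m ∷ n ∷ [])
... | Bézout.-+ x y 1+xm≡yn = - + x , + y ,
  combine₁ 1ℤ (cast-identity y x n m 1+xm≡yn) (rearrange (+ x) (+ y) (+ m) (+ n))
  where
  rearrange : ∀ x y m n → - x * m + y * n - 1ℤ ≡ 1ℤ * (y * n - (1ℤ + x * m))
  rearrange x y m n = solve (x ∷ y ∷ m ∷ n ∷ [])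

inverse-mod : ∀ {p n} .{{_ : NonZero n}} → Prime p → n < p → Σ ℤ λ p′ → p′ * + p ≡ 1ℤ mod n
inverse-mod {p} {n} p-prime n<p with bezout (Coprimality.prime⇒coprime p-prime n<p)
... | u , v , up+vn≡1 = u , mod-intro (- v) (combine₁ 1ℤ up+vn≡1 (rearrange u v (+ p) (+ n)))
  where
  rearrange : ∀ u v p n → u * p - (1ℤ + - v * n) ≡ 1ℤ * (u * p + v * n - 1ℤ)
  rearrange u v p n = solve (u ∷ v ∷ p ∷ n ∷ [])

lift-point : ∀ {n} E q P i j c u v → u * E + v * q ≡ 1ℤ → c * P ≡ E * i - q * j mod n →
  Σ ℤ λ x₀ → Σ ℤ λ y₀ → x₀ ≡ i mod n × y₀ ≡ j mod n × E * x₀ ≡ q * y₀ + c * P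
lift-point {n} E q P i j c u v uE+vq≡1 (by-divisibility (divides D cP-T≡Dn)) =
  i + u * D * + n , j + - v * D * + n , mod-intro (u * D) refl , mod-intro (- v * D) refl ,
  combine₂ (D * + n) (- 1ℤ) uE+vq≡1 cP-T≡Dn (identity E q P i j c u v D (+ n))
  where
  identity : ∀ E q P i j c u v D n →
    E * (i + u * D * n) - (q * (j + - v * D * n) + c * P)
      ≡ D * n * (u * E + v * q - 1ℤ) + - 1ℤ * (c * P - (E * i - q * j) - D * n)
  identity E q P i j c u v D n = solve (E ∷ q ∷ P ∷ i ∷ j ∷ c ∷ u ∷ v ∷ D ∷ n ∷ [])

-- c ∈ [s - n, s), recorded by sign: c = K with K < s, or c = -K with 1 ≤ K and K + s ≤ n.
OffsetRange : (n s : ℕ) → ℤ → Set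
OffsetRange n s c = (Σ ℕ λ K → c ≡ + K × K < s) ⊎ (Σ ℕ λ K → c ≡ - + K × 1 ≤ K × K ℕ.+ s ≤ n)

offset-cases : ∀ {ρ s n} → ρ < n → OffsetRange n s (+ (ρ ℕ.+ s) - + n)
offset-cases {ρ} {s} {n} ρ<n with n ℕ.≤? ρ ℕ.+ s
... | yes n≤ρ+s = inj₁ (ρ ℕ.+ s ℕ.∸ n , sym (pos-∸ n≤ρ+s) ,
  ℕₚ.+-cancelʳ-< n (ρ ℕ.+ s ℕ.∸ n) s (begin-strict
    ρ ℕ.+ s ℕ.∸ n ℕ.+ n   ≡⟨ ℕₚ.m∸n+n≡m n≤ρ+s ⟩
    ρ ℕ.+ s               <⟨ ℕₚ.+-monoˡ-< s ρ<n ⟩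
    n ℕ.+ s               ≡⟨ ℕₚ.+-comm n s ⟩
    s ℕ.+ n               ∎))
  where open ℕₚ.≤-Reasoning
... | no n≰ρ+s = inj₂ (n ℕ.∸ (ρ ℕ.+ s) ,
  trans (ℤₚ.m-n≡m⊖n (ρ ℕ.+ s) n) (ℤₚ.⊖-< ρ+s<n) , ℕₚ.m<n⇒0<n∸m ρ+s<n ,
  (begin
    n ℕ.∸ (ρ ℕ.+ s) ℕ.+ s             ≤⟨ ℕₚ.+-monoʳ-≤ (n ℕ.∸ (ρ ℕ.+ s)) (ℕₚ.m≤n+m s ρ) ⟩
    n ℕ.∸ (ρ ℕ.+ s) ℕ.+ (ρ ℕ.+ s)     ≡⟨ ℕₚ.m∸n+n≡m (ℕₚ.<⇒≤ ρ+s<n) ⟩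
    n                                 ∎))
  where
  open ℕₚ.≤-Reasoning
  ρ+s<n : ρ ℕ.+ s < n
  ρ+s<n = ℕₚ.≰⇒> n≰ρ+s

-- If p′·p ≡ 1 (mod n), then c = ρ + s - n with ρ = (p′·T - s) mod n lies in [s - n, s) and
-- solves c·p ≡ T (mod n), since c ≡ p′·T (mod n).
offset-from-inverse : ∀ {p n} .{{_ : NonZero n}} p′ → p′ * + p ≡ 1ℤ mod n → ∀ T s →
  Σ ℤ λ c → c * + p ≡ T mod n × OffsetRange n s c
offset-from-inverse {p} {n} p′ p′p≡1 T s = + (ρ ℕ.+ s) - + n , cp≡T , offset-cases ρ<n
  where
  ρ : ℕ
  ρ = (p′ * T - + s) %ℕ n
  ρ<n : ρ < n
  ρ<n = n%ℕd<d (p′ * T - + s) n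
  drop-n : ∀ a n → a - n ≡ a + - 1ℤ * n
  drop-n a n = solve (a ∷ n ∷ [])
  cancel-s : ∀ a s → a - s + s ≡ a
  cancel-s a s = solve (a ∷ s ∷ [])
  regroup : ∀ p′ T p → p′ * T * p ≡ p′ * p * T
  regroup p′ T p = solve (p′ ∷ T ∷ p ∷ [])
  open ModReasoning n
  cp≡T : (+ (ρ ℕ.+ s) - + n) * + p ≡ T mod n
  cp≡T = begin
    (+ (ρ ℕ.+ s) - + n) * + p       ≈⟨ mod-*ʳ (+ p) (mod-intro {b = + (ρ ℕ.+ s)} (- 1ℤ) (drop-n (+ (ρ ℕ.+ s)) (+ n))) ⟩
    + (ρ ℕ.+ s) * + p               ≡⟨ cong (_* + p) (ℤₚ.pos-+ ρ s) ⟩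
    (+ ρ + + s) * + p               ≈⟨ mod-*ʳ (+ p) (mod-+ (%ℕ-congruent (p′ * T - + s) n) (mod-refl {a = + s})) ⟩
    (p′ * T - + s + + s) * + p      ≡⟨ cong (_* + p) (cancel-s (p′ * T) (+ s)) ⟩
    p′ * T * + p                    ≡⟨ regroup p′ T (+ p) ⟩
    p′ * + p * T                    ≈⟨ mod-*ʳ T p′p≡1 ⟩
    1ℤ * T                          ≡⟨ ℤₚ.*-identityˡ T ⟩
    T                               ∎

reclassify : ∀ {P n a b i j i′ j′} → LinePoint P n a b i j → i ≡ i′ mod n → j ≡ j′ mod n →
  LinePoint P n a b i′ j′
reclassify point i≡i′ j≡j′ = record
  { x = x ; y = y ; x∈I = x∈I ; y∈I = y∈I
  ; x≡i = mod-trans x≡i i≡i′ ; y≡j = mod-trans y≡j j≡j′ ; on-line = on-line }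
  where open LinePoint point

swap-point : ∀ {P n a b i j} → LinePoint P n a b i j → LinePoint P n b a j i
swap-point point = record
  { x = y ; y = x ; x∈I = y∈I ; y∈I = x∈I ; x≡i = y≡j ; y≡j = x≡i ; on-line = mod-sym on-line }
  where open LinePoint point

-- s is an admissible offset for the line E·x ≡ q·y (mod p) when every c ∈ [s - n, s) gives
-- window bounds: for c = K ≥ 0 on E·x = q·y + p·K, for c = -K < 0 on q·y = E·x + p·K.
Admissible : (p n q E s : ℕ) → Set
Admissible p n q E s =
  (∀ K → K < s → WindowBound p n q E K) × (∀ K → 1 ≤ K → K ℕ.+ s ≤ n → WindowBound p n E q K)

-- With an admissible offset, the line E·x ≡ q·y (mod p) meets every pair of residue classes
-- mod n inside I × I: choose c ∈ [s - n, s) with c·p ≡ E·i - q·j (mod n), lift it to an integer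
-- point of E·x = q·y + c·p in the classes (i, j), and slide that point into the window.
line-meets-classes : ∀ {p n q E s} .{{_ : NonZero n}} → Prime p → n < p → Coprime q E →
  Admissible p n q E s → ∀ i j → LinePoint p n q E i j
line-meets-classes {p} {n} {q} {E} {s} p-prime n<p coprime (fits⁺ , fits⁻) i j =
  let p′ , p′p≡1       = inverse-mod p-prime n<p
      c , cp≡T , range = offset-from-inverse p′ p′p≡1 (+ E * i - + q * j) s
      u , v , uE+vq≡1  = bezout (Coprimality.sym coprime)
  in place range (lift-point (+ E) (+ q) (+ p) i j c u v uE+vq≡1 cp≡T)
  where
  reverse : ∀ q y₀ E x₀ p K → q * y₀ - (E * x₀ + p * K) ≡ - 1ℤ * (E * x₀ - (q * y₀ + - K * p))
  reverse q y₀ E x₀ p K = solve (q ∷ y₀ ∷ E ∷ x₀ ∷ p ∷ K ∷ [])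
  place : ∀ {c} → OffsetRange n s c →
    (Σ ℤ λ x₀ → Σ ℤ λ y₀ → x₀ ≡ i mod n × y₀ ≡ j mod n × + E * x₀ ≡ + q * y₀ + c * + p) →
    LinePoint p n q E i j
  place (inj₁ (K , c≡K , K<s)) (x₀ , y₀ , x₀≡i , y₀≡j , line) =
    reclassify (window (fits⁺ K K<s) x₀ y₀ Ex₀≡qy₀+pK) x₀≡i y₀≡j
    where
    Ex₀≡qy₀+pK : + E * x₀ ≡ + q * y₀ + + p * + K
    Ex₀≡qy₀+pK = trans line (cong (λ t → + q * y₀ + t) (trans (cong (_* + p) c≡K) (ℤₚ.*-comm (+ K) (+ p))))
  place (inj₂ (K , c≡-K , 1≤K , K+s≤n)) (x₀ , y₀ , x₀≡i , y₀≡j , line) =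
    swap-point (reclassify (window (fits⁻ K 1≤K K+s≤n) y₀ x₀ qy₀≡Ex₀+pK) y₀≡j x₀≡i)
    where
    qy₀≡Ex₀+pK : + q * y₀ ≡ + E * x₀ + + p * + K
    qy₀≡Ex₀+pK = combine₁ (- 1ℤ) (trans line (cong (λ t → + q * y₀ + t * + p) c≡-K))
                   (reverse (+ q) y₀ (+ E) x₀ (+ p) (+ K))

absorb : ∀ {X K Y} p F → X < p ℕ.* F → K ℕ.+ F ≤ Y → X ℕ.+ p ℕ.* K < p ℕ.* Y
absorb {X} {K} {Y} p F X<pF K+F≤Y = begin-strict
  X ℕ.+ p ℕ.* K         <⟨ ℕₚ.+-monoˡ-< (p ℕ.* K) X<pF ⟩
  p ℕ.* F ℕ.+ p ℕ.* K   ≡⟨ ℕₚ.*-distribˡ-+ p F K ⟨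
  p ℕ.* (F ℕ.+ K)       ≡⟨ cong (p ℕ.*_) (ℕₚ.+-comm F K) ⟩
  p ℕ.* (K ℕ.+ F)       ≤⟨ ℕₚ.*-monoʳ-≤ p K+F≤Y ⟩
  p ℕ.* Y               ∎
  where open ℕₚ.≤-Reasoning

cube-bound : ∀ {n a b} → a ≤ n → b ≤ n → n ℕ.* a ℕ.* b ≤ n ℕ.* n ℕ.* n
cube-bound {n} a≤n b≤n = ℕₚ.*-mono-≤ (ℕₚ.*-monoʳ-≤ n a≤n) b≤n

-- X < p when X ≤ n³ < p, written as X < p·1 for absorb.
below-p : ∀ {X p} n → X ≤ n ℕ.* n ℕ.* n → n ℕ.* n ℕ.* n < p → X < p ℕ.* 1
below-p {p = p} n X≤n³ n³<p = subst (_ <_) (sym (ℕₚ.*-identityʳ p)) (ℕₚ.≤-<-trans X≤n³ n³<p)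

≤-scaled : ∀ {n F E} .{{_ : NonZero n}} → 1 ≤ F → n ℕ.+ F ≡ suc E → E ≤ n ℕ.* F
≤-scaled {suc n′} {F} {E} 1≤F n+F≡1+E = begin
  E                ≡⟨ ℕₚ.suc-injective n+F≡1+E ⟨
  n′ ℕ.+ F         ≤⟨ ℕₚ.+-monoˡ-≤ F (ℕₚ.m≤m*n n′ F {{ℕ.>-nonZero 1≤F}}) ⟩
  n′ ℕ.* F ℕ.+ F   ≡⟨ ℕₚ.+-comm (n′ ℕ.* F) F ⟩
  suc n′ ℕ.* F     ∎
  where open ℕₚ.≤-Reasoning

positive-gap : ∀ {q n E} → q ≤ n → n < q ℕ.+ E → 1 ≤ E
positive-gap {q} {n} {zero}  q≤n n<q+0 = contradiction (subst (n <_) (ℕₚ.+-identityʳ q) n<q+0) (ℕₚ.≤⇒≯ q≤n)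
positive-gap {E = suc _} _ _ = s≤s z≤n

-- An admissible offset exists when 1 ≤ q ≤ n < q + E, n·E < p and n³ < p: take s = n if
-- n ≤ E (then only offsets c ≥ 0 occur, and E = (n - 1) + F gives n·q·E ≤ n³·F < p·F),
-- and s = E if E < n (then n·q·E < p, and every |c| stays below the relevant coefficient).
admissible-offset : ∀ {p n q E} .{{_ : NonZero n}} → 1 ≤ q → q ≤ n → n < q ℕ.+ E →
  n ℕ.* E < p → n ℕ.* n ℕ.* n < p → Σ ℕ (Admissible p n q E)
admissible-offset {p} {n} {q} {E} 1≤q q≤n n<q+E nE<p n³<p = choose (n ℕ.≤? E)
  where
  1≤E : 1 ≤ E
  1≤E = positive-gap q≤n n<q+E
  choose : Dec (n ≤ E) → Σ ℕ (Admissible p n q E)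
  choose (yes n≤E) = n , fits⁺ , λ K 1≤K K+n≤n → contradiction K+n≤n (ℕₚ.<⇒≱ (ℕₚ.+-monoˡ-≤ n 1≤K))
    where
    F : ℕ
    F = suc E ℕ.∸ n
    n+F≡1+E : n ℕ.+ F ≡ suc E
    n+F≡1+E = ℕₚ.m+[n∸m]≡n (ℕₚ.m≤n⇒m≤1+n n≤E)
    1≤F : 1 ≤ F
    1≤F = ℕₚ.m<n⇒0<n∸m (s≤s n≤E)
    nqE<pF : n ℕ.* q ℕ.* E < p ℕ.* F
    nqE<pF = begin-strict
      n ℕ.* q ℕ.* E              ≤⟨ ℕₚ.*-mono-≤ (ℕₚ.*-monoʳ-≤ n q≤n) (≤-scaled 1≤F n+F≡1+E) ⟩
      n ℕ.* n ℕ.* (n ℕ.* F)      ≡⟨ ℕₚ.*-assoc (n ℕ.* n) n F ⟨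
      n ℕ.* n ℕ.* n ℕ.* F        <⟨ ℕₚ.*-monoˡ-< F {{ℕ.>-nonZero 1≤F}} n³<p ⟩
      p ℕ.* F                    ∎
      where open ℕₚ.≤-Reasoning
    fits⁺ : ∀ K → K < n → WindowBound p n q E K
    fits⁺ K K<n = 1≤q , 1≤E , nE<p , absorb p F nqE<pF (ℕₚ.+-cancelˡ-≤ 1 (K ℕ.+ F) E (begin
      suc K ℕ.+ F   ≤⟨ ℕₚ.+-monoˡ-≤ F K<n ⟩
      n ℕ.+ F       ≡⟨ n+F≡1+E ⟩
      suc E         ∎))
      where open ℕₚ.≤-Reasoning
  choose (no n≰E) = E ,
    (λ K K<E → 1≤q , 1≤E , nE<p ,
       absorb p 1 (below-p n (cube-bound q≤n E≤n) n³<p) (subst (_≤ E) (ℕₚ.+-comm 1 K) K<E)) ,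
    (λ K 1≤K K+E≤n → 1≤E , 1≤q , nq<p ,
       absorb p 1 (below-p n (cube-bound E≤n q≤n) n³<p)
              (subst (_≤ q) (ℕₚ.+-comm 1 K) (ℕₚ.+-cancelʳ-< E K q (ℕₚ.≤-<-trans K+E≤n n<q+E))))
    where
    E≤n : E ≤ n
    E≤n = ℕₚ.<⇒≤ (ℕₚ.≰⇒> n≰E)
    nq<p : n ℕ.* q < p
    nq<p = ℕₚ.≤-<-trans (ℕₚ.≤-trans (ℕₚ.*-monoʳ-≤ n q≤n) (ℕₚ.m≤m*n (n ℕ.* n) n)) n³<p

-- If q·A ≡ e (mod p) with 0 < q < p, and e·x ≡ q·z (mod p) for some z ≡ y (mod p) with
-- y < p, then f(x) = y: indeed q·(A·x) ≡ e·x ≡ q·y, and q cancels.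
image-from-line : ∀ {p q A e x z y} .{{_ : NonZero p}} → Prime p → 1 ≤ q → q < p →
  + q * A ≡ e mod p → e * + x ≡ + q * z mod p → z ≡ + y mod p → y < p → f p A x ≡ y
image-from-line {p} {q} {A} {e} {x} {z} {y} p-prime 1≤q q<p qA≡e ex≡qz z≡y y<p =
  f-unique A x y<p (mod-sym (prime-cancel p-prime 1≤q q<p (begin
    + q * (A * + x)     ≡⟨ ℤₚ.*-assoc (+ q) A (+ x) ⟨
    + q * A * + x       ≈⟨ mod-*ʳ (+ x) qA≡e ⟩
    e * + x             ≈⟨ ex≡qz ⟩
    + q * z             ≈⟨ mod-*ˡ (+ q) z≡y ⟩
    + q * + y           ∎)))
  where open ModReasoning p

line-meets-all-classes : ∀ {p n q E} .{{_ : NonZero n}} → Prime p → n < p → n ℕ.* n ℕ.* n < p →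
  1 ≤ q → q ≤ n → Coprime q E → n < q ℕ.+ E → n ℕ.* E < p → ∀ i j → LinePoint p n q E i j
line-meets-all-classes p-prime n<p n³<p 1≤q q≤n coprime n<q+E nE<p =
  line-meets-classes p-prime n<p coprime (proj₂ (admissible-offset 1≤q q≤n n<q+E nE<p n³<p))

hit-from-point⁺ : ∀ {p n q A E i j} .{{_ : NonZero p}} .{{_ : NonZero n}} → Prime p →
  1 ≤ q → q < p → i < n → j < n → + q * A ≡ + E mod p → LinePoint p n q E (+ i) (+ j) →
  Σ ℕ λ x → InIj p n i x × InIj p n j (f p A x)
hit-from-point⁺ {p} {n} {A = A} {j = j} p-prime 1≤q q<p i<n j<n qA≡E point =
  x , (x∈I , %-unique i<n x≡i) , subst (InIj p n j) (sym fx≡y) (y∈I , %-unique j<n y≡j)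
  where
  open LinePoint point
  fx≡y : f p A x ≡ y
  fx≡y = image-from-line p-prime 1≤q q<p qA≡E on-line mod-refl (proj₂ y∈I)

-- If q·A ≡ -E (mod p), a point (x, y′) of E·x ≡ q·y′ (mod p) in the classes (i, p - j)
-- gives x ∈ I_i with f(x) = p - y′ ∈ I_j, since -E·x ≡ -q·y′ ≡ q·(p - y′).
hit-from-point⁻ : ∀ {p n q A E i j} .{{_ : NonZero p}} .{{_ : NonZero n}} → Prime p →
  1 ≤ q → q < p → i < n → j < n → + q * A ≡ - + E mod p → LinePoint p n q E (+ i) (+ p - + j) →
  Σ ℕ λ x → InIj p n i x × InIj p n j (f p A x)
hit-from-point⁻ {p} {n} {q} {A} {E} {j = j} p-prime 1≤q q<p i<n j<n qA≡-E point =
  x , (x∈I , %-unique i<n x≡i) , subst (InIj p n j) (sym fx≡y) (y∈I′ , %-unique j<n y≡j′)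
  where
  open LinePoint point renaming (y to y′; y∈I to y′∈I; y≡j to y′≡p-j)
  y′≤p : y′ ≤ p
  y′≤p = ℕₚ.<⇒≤ (proj₂ y′∈I)
  y : ℕ
  y = p ℕ.∸ y′
  y∈I′ : InI p y
  y∈I′ = ℕₚ.m<n⇒0<n∸m (proj₂ y′∈I) , ℕₚ.∸-monoʳ-< (proj₁ y′∈I) y′≤p
  y≡j′ : + y ≡ + j mod n
  y≡j′ = begin
    + y                  ≡⟨ pos-∸ y′≤p ⟩
    + p - + y′           ≈⟨ mod-+ (mod-refl {a = + p}) (mod-neg y′≡p-j) ⟩
    + p - (+ p - + j)    ≡⟨ flip (+ p) (+ j) ⟩
    + j                  ∎
    where
    open ModReasoning n
    flip : ∀ p j → p - (p - j) ≡ j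
    flip p j = solve (p ∷ j ∷ [])
  -Ex≡q[-y′] : - + E * + x ≡ + q * - + y′ mod p
  -Ex≡q[-y′] = begin
    - + E * + x          ≡⟨ ℤₚ.neg-distribˡ-* (+ E) (+ x) ⟨
    - (+ E * + x)        ≈⟨ mod-neg on-line ⟩
    - (+ q * + y′)       ≡⟨ ℤₚ.neg-distribʳ-* (+ q) (+ y′) ⟩
    + q * - + y′         ∎
    where open ModReasoning p
  -y′≡y : - + y′ ≡ + y mod p
  -y′≡y = mod-intro (- 1ℤ) (trans (wrap (+ p) (+ y′)) (cong (λ t → t + - 1ℤ * + p) (sym (pos-∸ y′≤p))))
    where
    wrap : ∀ p y′ → - y′ ≡ p - y′ + - 1ℤ * p
    wrap p y′ = solve (p ∷ y′ ∷ [])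
  fx≡y : f p A x ≡ y
  fx≡y = image-from-line p-prime 1≤q q<p qA≡-E -Ex≡q[-y′] -y′≡y (proj₂ y∈I′)

all-pairs-hit : ∀ {p n A} .{{_ : NonZero p}} .{{_ : NonZero n}} → Prime p → n < p →
  n ℕ.* n ℕ.* n < p → (approx : Approximation p n A) →
  let open Approximation approx in Coprime q ∣ e ∣ → n < q ℕ.+ ∣ e ∣ →
  ∀ {i j} → i < n → j < n → Σ ℕ λ x → InIj p n i x × InIj p n j (f p A x)
all-pairs-hit {p} {n} {A} p-prime n<p n³<p approx coprime n<q+∣e∣ {i} {j} i<n j<n =
  hit e qA≡e coprime n<q+∣e∣ n∣e∣<p
  where
  open Approximation approx using (q; e; 1≤q; q≤n; n∣e∣<p; qA≡e)
  q<p : q < p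
  q<p = ℕₚ.≤-<-trans q≤n n<p
  hit : ∀ e → + q * A ≡ e mod p → Coprime q ∣ e ∣ → n < q ℕ.+ ∣ e ∣ → n ℕ.* ∣ e ∣ < p →
    Σ ℕ λ x → InIj p n i x × InIj p n j (f p A x)
  hit (+ E) qA≡E coprime n<q+E nE<p = hit-from-point⁺ p-prime 1≤q q<p i<n j<n qA≡E
    (line-meets-all-classes p-prime n<p n³<p 1≤q q≤n coprime n<q+E nE<p (+ i) (+ j))
  hit -[1+ E′ ] qA≡-E coprime n<q+E nE<p = hit-from-point⁻ p-prime 1≤q q<p i<n j<n qA≡-E
    (line-meets-all-classes p-prime n<p n³<p 1≤q q≤n coprime n<q+E nE<p (+ i) (+ p - + j))

-- A coprime approximation q·A ≡ e (mod p) with q + |e| ≤ n is a representation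
-- A = (t·p - r)/s with s = q, r = -e and t the quotient of q·A - e by p.
approximation⇒representable : ∀ {p n A} (approx : Approximation p n A) →
  let open Approximation approx in Coprime q ∣ e ∣ → q ℕ.+ ∣ e ∣ ≤ n → Representable p n A
approximation⇒representable {p} {n} {A} approx coprime q+∣e∣≤n
  with Approximation.qA≡e approx
... | by-divisibility (divides t qA-e≡tp) =
  t , - e , + q , ℤ.+<+ 1≤q ,
  cong +_ (trans (cong (λ m → gcd m q) (ℤₚ.∣-i∣≡∣i∣ e)) (Coprimality.coprime⇒gcd≡1 (Coprimality.sym coprime))) ,
  ℕₚ.≤-trans 1≤q (ℕₚ.m≤n+m q ∣ - e ∣) ,
  subst (λ m → m ℕ.+ q ≤ n) (sym (ℤₚ.∣-i∣≡∣i∣ e)) (subst (_≤ n) (ℕₚ.+-comm q ∣ e ∣) q+∣e∣≤n) ,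
  combine₁ 1ℤ qA-e≡tp (rearrange (+ q * A) e (t * + p))
  where
  open Approximation approx
  rearrange : ∀ qA e tp → qA - (tp - - e) ≡ 1ℤ * (qA - e - tp)
  rearrange qA e tp = solve (qA ∷ e ∷ tp ∷ [])

typeIV⇒representable : ∀ {p n A} .{{_ : NonZero p}} .{{_ : NonZero n}} → Prime p → n < p →
  n ℕ.* n ℕ.* n < p → TypeIV p n A → Representable p n A
typeIV⇒representable {p} {n} {A} p-prime n<p n³<p (i , j , i<n , j<n , misses) =
  decide (q ℕ.+ ∣ e ∣ ℕ.≤? n)
  where
  approximation : Σ (Approximation p n A) λ a → Coprime (Approximation.q a) ∣ Approximation.e a ∣
  approximation = coprime-approximation p-prime n<p (dirichlet p n A)
  approx : Approximation p n A
  approx = proj₁ approximation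
  open Approximation approx using (q; e)
  decide : Dec (q ℕ.+ ∣ e ∣ ≤ n) → Representable p n A
  decide (yes small) = approximation⇒representable approx (proj₂ approximation) small
  decide (no large)  =
    let x , x∈Iᵢ , fx∈Iⱼ = all-pairs-hit p-prime n<p n³<p approx (proj₂ approximation) (ℕₚ.≰⇒> large) i<n j<n
    in contradiction fx∈Iⱼ (misses x x∈Iᵢ)

cube<p : ∀ {n p} .{{_ : NonZero n}} → n ^ 3 ℕ.* (n ℕ.+ 3) < p → n ℕ.* n ℕ.* n < p
cube<p {n} {p} bound = ℕₚ.≤-<-trans (begin
  n ℕ.* n ℕ.* n               ≡⟨ ℕₚ.*-assoc n n n ⟩
  n ℕ.* (n ℕ.* n)             ≡⟨ cong (λ m → n ℕ.* (n ℕ.* m)) (ℕₚ.*-identityʳ n) ⟨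
  n ^ 3                       ≤⟨ ℕₚ.m≤m*n (n ^ 3) (n ℕ.+ 3) {{ℕ.>-nonZero (ℕₚ.≤-trans (s≤s z≤n) (ℕₚ.m≤n+m 3 n))}} ⟩
  n ^ 3 ℕ.* (n ℕ.+ 3)         ∎) bound
  where open ℕₚ.≤-Reasoning

n≤n³ : ∀ n .{{_ : NonZero n}} → n ≤ n ℕ.* n ℕ.* n
n≤n³ n = ℕₚ.≤-trans (ℕₚ.m≤m*n n n) (ℕₚ.m≤m*n (n ℕ.* n) n)

theorem1p5 : (p n : ℕ) → (A : ℤ) → .{{_ : NonZero p}} → .{{_ : NonZero n}} →
    Prime p → p ≢ 2 → 2 ≤ n →
    2 ℕ.* ∣ A ∣ < p → ¬ ((+ p) ∣ A) →
    n ^ 3 ℕ.* (n ℕ.+ 3) < p →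
    TypeIV p n A ⇔ Representable p n A
theorem1p5 p n A p-prime _ _ _ _ bound =
  mk⇔ (typeIV⇒representable p-prime n<p n³<p) (representable⇒typeIV p-prime n<p)
  where
  n³<p : n ℕ.* n ℕ.* n < p
  n³<p = cube<p bound
  n<p : n < p
  n<p = ℕₚ.≤-<-trans (n≤n³ n) n³<p
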